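{- Let $L$ be a complete lattice and let $S$ be a subsemiring of $\mathrm{FinAdd}_L$ (i.e. $\bot,\mathrm{id}\in S$ and $S$ is closed under $\vee$ and composition) which is closed under $f\mapsto f^*$. If each $f\in S$ is locally $^*$-closed and $\top$-continuous, then $S$ is a $^*$-continuous Kleene algebra.
   Context: Functions are written on the right and composed left to right: $xf$ is $f$ applied to $x$, $fg$ means "first $f$, then $g$". For complete lattices $L,L'$ (least element $\bot$, greatest $\top$), $f:L\to L'$ is finitely additive if $\bot f=\bot$ and $(x\vee y)f=xf\vee yf$ for all $x,y$. $\mathrm{FinAdd}_{L,L'}$ is the set of finitely additive maps $L\to L'$, ordered pointwise, with pointwise suprema; $\bot$ also denotes the constant map with value $\bot$; $\mathrm{FinAdd}_L=\mathrm{FinAdd}_{L,L}$, an idempotent semiring under $\vee$, composition, $\bot$ and identity $\mathrm{id}$. For $f\in\mathrm{FinAdd}_L$: $f^0=\mathrm{id}$, $f^{n+1}=f^nf$, $f^*=\bigvee_{n\ge0}f^n$ (pointwise). $f\in\mathrm{FinAdd}_{L,L'}$ is $\top$-continuous if $f=\bot$ or for every $X\subseteq L$ with $\bigvee X=\top$ we have $\bigvee_{x\in X}xf=\top$. $f\in\mathrm{FinAdd}_L$ is locally $^*$-closed if for every $x\in L$ either $xf^*=\top$ or there is $N\ge0$ with $xf^*=x\vee xf\vee\dots\vee xf^N$. Such an $S$ is a $^*$-continuous Kleene algebra if it is a Kleene algebra (for all $x,y\in S$, $yx^*$ is the least $z\in S$ with $z=zx\vee y$ and $x^*y$ the least $z\in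 S$ with $z=xz\vee y$), $x^*=\bigvee_nx^n$, and $y(\bigvee_nx^n)=\bigvee_nyx^n$, $(\bigvee_nx^n)y=\bigvee_nx^ny$ for all $x,y\in S$ (suprema pointwise). -}

module Defs where

open import Level using (Level; suc; _⊔_)
open import Data.Nat using (ℕ; zero) renaming (suc to sucℕ)
open import Data.Product using (Σ; _×_; _,_)
open import Data.Sum using (_⊎_)
open import Data.Empty.Polymorphic using (⊥)
open import Data.Unit.Polymorphic using (⊤)
open import Relation.Binary.PropositionalEquality using (_≡_)
open import Relation.Binary.Structures using (IsPartialOrder)

record CompleteLattice (c ℓ : Level) : Set (suc (c ⊔ ℓ)) where
  field
    Carrier        : Set c
    _≤_            : Carrier → Carrier → Set ℓ
    isPartialOrder : IsPartialOrder _≡_ _≤_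
    ⋁              : (Carrier → Set c) → Carrier
    ⋁-upper        : (X : Carrier → Set c) (x : Carrier) → X x → x ≤ ⋁ X
    ⋁-least        : (X : Carrier → Set c) (u : Carrier) →
                     ((x : Carrier) → X x → x ≤ u) → ⋁ X ≤ u

module _ {c ℓ : Level} (L : CompleteLattice c ℓ) where
  open CompleteLattice L

  bot : Carrier
  bot = ⋁ (λ _ → ⊥)

  top : Carrier
  top = ⋁ (λ _ → ⊤)

  _∨_ : Carrier → Carrier → Carrier
  x ∨ y = ⋁ (λ z → (z ≡ x) ⊎ (z ≡ y))

  ⋁ℕ : (ℕ → Carrier) → Carrier
  ⋁ℕ a = ⋁ (λ z → Σ ℕ (λ n → z ≡ a n))

  -- maps L → L; functions are written on the right in the paper:
  -- "x f" is (f x), and "f g" (first f, then g) is  λ x → g (f x).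
  Map : Set c
  Map = Carrier → Carrier

  idMap : Map
  idMap x = x

  botMap : Map
  botMap _ = bot

  _⨾_ : Map → Map → Map
  (f ⨾ g) x = g (f x)

  _∨ₘ_ : Map → Map → Map
  (f ∨ₘ g) x = f x ∨ g x

  _≐_ : Map → Map → Set c
  f ≐ g = (x : Carrier) → f x ≡ g x

  _⊑_ : Map → Map → Set (c ⊔ ℓ)
  f ⊑ g = (x : Carrier) → f x ≤ g x

  FinAdd : Map → Set c
  FinAdd f = (f bot ≡ bot) × ((x y : Carrier) → f (x ∨ y) ≡ (f x ∨ f y))

  pow : Map → ℕ → Map
  pow f zero     = idMap
  pow f (sucℕ n) = pow f n ⨾ f

  star : Map → Map
  star f x = ⋁ℕ (λ n → pow f n x)

  joinUpTo : Map → Carrier → ℕ → Carrier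
  joinUpTo f x zero     = x
  joinUpTo f x (sucℕ N) = joinUpTo f x N ∨ pow f (sucℕ N) x

  LocallyStarClosed : Map → Set c
  LocallyStarClosed f =
    (x : Carrier) → (star f x ≡ top) ⊎ Σ ℕ (λ N → star f x ≡ joinUpTo f x N)

  TopContinuous : Map → Set (suc c)
  TopContinuous f =
    (f ≐ botMap) ⊎
    ((X : Carrier → Set c) → ⋁ X ≡ top →
       ⋁ (λ y → Σ Carrier (λ x → X x × (y ≡ f x))) ≡ top)

  record IsSubsemiringFinAdd {s : Level} (S : Map → Set s) : Set (c ⊔ s) where
    field
      ⊆FinAdd : (f : Map) → S f → FinAdd f
      bot∈    : S botMap
      id∈     : S idMap
      ∨-closed : (f g : Map) → S f → S g → S (f ∨ₘ g)
      ⨾-closed : (f g : Map) → S f → S g → S (f ⨾ g)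

  StarClosed : {s : Level} → (Map → Set s) → Set (c ⊔ s)
  StarClosed S = (f : Map) → S f → S (star f)

  record IsKleeneAlgebra {s : Level} (S : Map → Set s) : Set (c ⊔ ℓ ⊔ s) where
    field
      right-∈     : (x y : Map) → S x → S y → S (y ⨾ star x)
      right-fix   : (x y : Map) → S x → S y →
                    (y ⨾ star x) ≐ (((y ⨾ star x) ⨾ x) ∨ₘ y)
      right-least : (x y : Map) → S x → S y → (z : Map) → S z →
                    z ≐ ((z ⨾ x) ∨ₘ y) → (y ⨾ star x) ⊑ z
      left-∈      : (x y : Map) → S x → S y → S (star x ⨾ y)
      left-fix    : (x y : Map) → S x → S y →
                    (star x ⨾ y) ≐ ((x ⨾ (star x ⨾ y)) ∨ₘ y)
      left-least  : (x y : Map) → S x → S y → (z : Map) → S z →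
                    z ≐ ((x ⨾ z) ∨ₘ y) → (star x ⨾ y) ⊑ z

  record IsStarContinuousKA {s : Level} (S : Map → Set s) : Set (c ⊔ ℓ ⊔ s) where
    field
      isKleeneAlgebra : IsKleeneAlgebra S
      star-sup  : (x : Map) → S x →
                  (a : Carrier) → star x a ≡ ⋁ℕ (λ n → pow x n a)
      -- y (⋁_n x^n) = ⋁_n y x^n
      left-cont  : (x y : Map) → S x → S y →
                   (a : Carrier) → star x (y a) ≡ ⋁ℕ (λ n → (y ⨾ pow x n) a)
      -- (⋁_n x^n) y = ⋁_n x^n y
      right-cont : (x y : Map) → S x → S y →
                   (a : Carrier) → y (⋁ℕ (λ n → pow x n a)) ≡ ⋁ℕ (λ n → (pow x n ⨾ y) a)

module Submission where

-- Writing x* a = ⋁ₙ xⁿ a, the equations "x* = ⋁ₙ xⁿ" and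
-- "(⋁ₙ xⁿ) y = ⋁ₙ xⁿ y" hold by definition, since composition is evaluation.
-- The real content is the other continuity law: a finitely additive,
-- ⊤-continuous y commutes with the supremum ⋁ₙ xⁿ a whenever x is locally
-- *-closed (lemma `preserves-star`).  Either x* a is a finite join
-- a ∨ x a ∨ … ∨ xᴺ a, which y preserves by additivity, or x* a = ⊤, and then
-- ⊤-continuity of y applied to the family (xⁿ a)ₙ gives the claim.
-- Taking y = x shows x x* = x* x, from which both fixed-point equations
-- follow by unfolding x* = x* x ∨ id.  Leastness is proved by bounding
-- every power separately by induction on n.

open import Level using (Level)
open import Defs
open import Data.Nat using (ℕ; zero) renaming (suc to sucℕ)
open import Data.Product using (Σ; _×_; _,_; proj₂)
open import Data.Sum using (_⊎_; inj₁; inj₂)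
open import Data.Unit.Polymorphic using (tt)
open import Relation.Binary.PropositionalEquality using (_≡_; refl; sym; trans; cong; subst)
open import Relation.Binary.Bundles using (Poset)
open import Relation.Binary.Structures using (IsPartialOrder)

module Theory {c ℓ : Level} (L : CompleteLattice c ℓ) where
  open CompleteLattice L
  open IsPartialOrder isPartialOrder using (antisym) renaming (trans to ≤-trans; reflexive to ≤-reflexive)

  poset : Poset c c ℓ
  poset = record { isPartialOrder = isPartialOrder }

  open import Relation.Binary.Reasoning.PartialOrder poset

  _⊔_ : Carrier → Carrier → Carrier
  _⊔_ = _∨_ L

  ⊔-upperˡ : (a b : Carrier) → a ≤ (a ⊔ b)
  ⊔-upperˡ a b = ⋁-upper _ a (inj₁ refl)

  ⊔-upperʳ : (a b : Carrier) → b ≤ (a ⊔ b)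
  ⊔-upperʳ a b = ⋁-upper _ b (inj₂ refl)

  ⊔-least : {a b u : Carrier} → a ≤ u → b ≤ u → (a ⊔ b) ≤ u
  ⊔-least {a} {b} {u} a≤u b≤u = ⋁-least _ u bound
    where
      bound : (z : Carrier) → (z ≡ a) ⊎ (z ≡ b) → z ≤ u
      bound z (inj₁ refl) = a≤u
      bound z (inj₂ refl) = b≤u

  ⊔-absorbs : {a b : Carrier} → a ≤ b → (a ⊔ b) ≡ b
  ⊔-absorbs {a} {b} a≤b = antisym (⊔-least a≤b (≤-reflexive refl)) (⊔-upperʳ a b)

  bot-least : (a : Carrier) → bot L ≤ a
  bot-least a = ⋁-least _ a (λ _ ())

  top-greatest : (a : Carrier) → a ≤ top L
  top-greatest a = ⋁-upper _ a tt

  ⋁ℕ-upper : (f : ℕ → Carrier) (n : ℕ) → f n ≤ ⋁ℕ L f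
  ⋁ℕ-upper f n = ⋁-upper _ (f n) (n , refl)

  ⋁ℕ-least : {f : ℕ → Carrier} {u : Carrier} → ((n : ℕ) → f n ≤ u) → ⋁ℕ L f ≤ u
  ⋁ℕ-least {f} {u} bound = ⋁-least _ u member-bound
    where
      member-bound : (z : Carrier) → Σ ℕ (λ n → z ≡ f n) → z ≤ u
      member-bound z (n , refl) = bound n

  ⋁ℕ-cong : {f g : ℕ → Carrier} → ((n : ℕ) → f n ≡ g n) → ⋁ℕ L f ≡ ⋁ℕ L g
  ⋁ℕ-cong {f} {g} f≡g = antisym
    (⋁ℕ-least (λ n → ≤-trans (≤-reflexive (f≡g n)) (⋁ℕ-upper g n)))
    (⋁ℕ-least (λ n → ≤-trans (≤-reflexive (sym (f≡g n))) (⋁ℕ-upper f n)))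

  -- A finitely additive map is monotone: a ≤ b gives f b = f (a ∨ b) = f a ∨ f b.
  finAdd-monotone : (f : Map L) → FinAdd L f → {a b : Carrier} → a ≤ b → f a ≤ f b
  finAdd-monotone f (_ , additive) {a} {b} a≤b = begin
    f a             ≤⟨ ⊔-upperˡ (f a) (f b) ⟩
    (f a ⊔ f b)     ≡⟨ sym (additive a b) ⟩
    f (a ⊔ b)       ≡⟨ cong f (⊔-absorbs a≤b) ⟩
    f b             ∎

  pow-shift : (x : Map L) (n : ℕ) (b : Carrier) → pow L x n (x b) ≡ pow L x (sucℕ n) b
  pow-shift x zero     b = refl
  pow-shift x (sucℕ n) b = cong x (pow-shift x n b)

  star-unfold : (x : Map L) (b : Carrier) → star L x b ≡ (star L x (x b) ⊔ b)
  star-unfold x b = antisym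
    (⋁ℕ-least power-bound)
    (⊔-least (⋁ℕ-least (λ n → begin
                pow L x n (x b)          ≡⟨ pow-shift x n b ⟩
                pow L x (sucℕ n) b       ≤⟨ ⋁ℕ-upper _ (sucℕ n) ⟩
                star L x b               ∎))
             (⋁ℕ-upper (λ n → pow L x n b) 0))
    where
      power-bound : (n : ℕ) → pow L x n b ≤ (star L x (x b) ⊔ b)
      power-bound zero     = ⊔-upperʳ _ _
      power-bound (sucℕ n) = begin
        pow L x (sucℕ n) b       ≡⟨ sym (pow-shift x n b) ⟩
        pow L x n (x b)          ≤⟨ ⋁ℕ-upper _ n ⟩
        star L x (x b)           ≤⟨ ⊔-upperˡ _ _ ⟩
        (star L x (x b) ⊔ b)     ∎

  finAdd-joinUpTo : (x y : Map L) → FinAdd L y → (a : Carrier) (N : ℕ) →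
    y (joinUpTo L x a N) ≤ ⋁ℕ L (λ n → y (pow L x n a))
  finAdd-joinUpTo x y finAdd-y a zero = ⋁ℕ-upper (λ n → y (pow L x n a)) 0
  finAdd-joinUpTo x y finAdd-y a (sucℕ N) = begin
    y (joinUpTo L x a N ⊔ pow L x (sucℕ N) a)
      ≡⟨ proj₂ finAdd-y _ _ ⟩
    (y (joinUpTo L x a N) ⊔ y (pow L x (sucℕ N) a))
      ≤⟨ ⊔-least (finAdd-joinUpTo x y finAdd-y a N)
                 (⋁ℕ-upper (λ n → y (pow L x n a)) (sucℕ N)) ⟩
    ⋁ℕ L (λ n → y (pow L x n a)) ∎

  topContinuous-⋁ℕ : (y : Map L) → TopContinuous L y → (f : ℕ → Carrier) →
    ⋁ℕ L f ≡ top L → y (⋁ℕ L f) ≤ ⋁ℕ L (λ n → y (f n))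
  topContinuous-⋁ℕ y (inj₁ y≐bot) f _ =
    ≤-trans (≤-reflexive (y≐bot _)) (bot-least _)
  topContinuous-⋁ℕ y (inj₂ continuous) f ⋁f≡top = begin
    y (⋁ℕ L f)              ≤⟨ top-greatest _ ⟩
    top L                   ≡⟨ sym (continuous _ ⋁f≡top) ⟩
    ⋁ image                 ≤⟨ ⋁-least image _ image-bound ⟩
    ⋁ℕ L (λ n → y (f n))    ∎
    where
      image : Carrier → Set c
      image w = Σ Carrier (λ z → Σ ℕ (λ n → z ≡ f n) × (w ≡ y z))

      image-bound : (w : Carrier) → image w → w ≤ ⋁ℕ L (λ n → y (f n))
      image-bound w (z , (n , refl) , refl) = ⋁ℕ-upper (λ n → y (f n)) n

  preserves-star : (x y : Map L) → LocallyStarClosed L x →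
    FinAdd L y → TopContinuous L y → (a : Carrier) →
    y (star L x a) ≡ ⋁ℕ L (λ n → y (pow L x n a))
  preserves-star x y closed-x finAdd-y continuous-y a =
    antisym upper (⋁ℕ-least (λ n → finAdd-monotone y finAdd-y (⋁ℕ-upper _ n)))
    where
      upper : y (star L x a) ≤ ⋁ℕ L (λ n → y (pow L x n a))
      upper with closed-x a
      ... | inj₁ star≡top = topContinuous-⋁ℕ y continuous-y _ star≡top
      ... | inj₂ (N , star≡join) =
        subst (λ w → y w ≤ _) (sym star≡join) (finAdd-joinUpTo x y finAdd-y a N)

  star-commutes : (x : Map L) → LocallyStarClosed L x → FinAdd L x → TopContinuous L x →
    (b : Carrier) → x (star L x b) ≡ star L x (x b)
  star-commutes x closed finAdd continuous b = begin-equality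
    x (star L x b)                  ≡⟨ preserves-star x x closed finAdd continuous b ⟩
    ⋁ℕ L (λ n → x (pow L x n b))    ≡⟨ ⋁ℕ-cong (λ n → sym (pow-shift x n b)) ⟩
    star L x (x b)                  ∎

  pow-below-postfix : (x y z : Map L) → (∀ {a b} → a ≤ b → x a ≤ x b) →
    ((a : Carrier) → z a ≡ (x (z a) ⊔ y a)) →
    (a : Carrier) (n : ℕ) → pow L x n (y a) ≤ z a
  pow-below-postfix x y z monotone z-eq a zero = begin
    y a                   ≤⟨ ⊔-upperʳ _ _ ⟩
    (x (z a) ⊔ y a)       ≡⟨ sym (z-eq a) ⟩
    z a                   ∎
  pow-below-postfix x y z monotone z-eq a (sucℕ n) = begin
    x (pow L x n (y a))   ≤⟨ monotone (pow-below-postfix x y z monotone z-eq a n) ⟩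
    x (z a)               ≤⟨ ⊔-upperˡ _ _ ⟩
    (x (z a) ⊔ y a)       ≡⟨ sym (z-eq a) ⟩
    z a                   ∎

  pow-below-prefix : (x y z : Map L) → ((a : Carrier) → z a ≡ (z (x a) ⊔ y a)) →
    (n : ℕ) (a : Carrier) → y (pow L x n a) ≤ z a
  pow-below-prefix x y z z-eq zero a = begin
    y a                   ≤⟨ ⊔-upperʳ _ _ ⟩
    (z (x a) ⊔ y a)       ≡⟨ sym (z-eq a) ⟩
    z a                   ∎
  pow-below-prefix x y z z-eq (sucℕ n) a = begin
    y (pow L x (sucℕ n) a)  ≡⟨ cong y (sym (pow-shift x n a)) ⟩
    y (pow L x n (x a))     ≤⟨ pow-below-prefix x y z z-eq n (x a) ⟩
    z (x a)                 ≤⟨ ⊔-upperˡ _ _ ⟩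
    (z (x a) ⊔ y a)         ≡⟨ sym (z-eq a) ⟩
    z a                     ∎

  isKleeneAlgebra : {s : Level} (S : Map L → Set s) →
    IsSubsemiringFinAdd L S → StarClosed L S →
    ((f : Map L) → S f → LocallyStarClosed L f) →
    ((f : Map L) → S f → TopContinuous L f) →
    IsKleeneAlgebra L S
  isKleeneAlgebra S sub star-closed closed continuous = record
    { right-∈     = λ x y Sx Sy → ⨾-closed y (star L x) Sy (star-closed x Sx)
    ; right-fix   = λ x y Sx Sy a → trans (star-unfold x (y a))
                      (cong (_⊔ y a) (sym (commutes x Sx (y a))))
    ; right-least = λ x y Sx Sy z Sz z-eq a →
                      ⋁ℕ-least (pow-below-postfix x y z (finAdd-monotone x (finAdd x Sx)) z-eq a)
    ; left-∈      = λ x y Sx Sy → ⨾-closed (star L x) y (star-closed x Sx) Sy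
    ; left-fix    = λ x y Sx Sy a → trans (cong y (star-unfold x a)) (proj₂ (finAdd y Sy) _ _)
    ; left-least  = λ x y Sx Sy z Sz z-eq a →
                      subst (_≤ z a) (sym (preserves x y Sx Sy a))
                        (⋁ℕ-least (λ n → pow-below-prefix x y z z-eq n a))
    }
    where
      open IsSubsemiringFinAdd sub using (⨾-closed) renaming (⊆FinAdd to finAdd)

      preserves : (x y : Map L) → S x → S y → (a : Carrier) →
        y (star L x a) ≡ ⋁ℕ L (λ n → y (pow L x n a))
      preserves x y Sx Sy = preserves-star x y (closed x Sx) (finAdd y Sy) (continuous y Sy)

      commutes : (x : Map L) → S x → (b : Carrier) → x (star L x b) ≡ star L x (x b)
      commutes x Sx = star-commutes x (closed x Sx) (finAdd x Sx) (continuous x Sx)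

mainTheorem5 : {c ℓ s : Level} (L : CompleteLattice c ℓ) (S : Map L → Set s) →
    IsSubsemiringFinAdd L S → StarClosed L S →
    ((f : Map L) → S f → LocallyStarClosed L f) →
    ((f : Map L) → S f → TopContinuous L f) →
    IsStarContinuousKA L S
mainTheorem5 L S sub star-closed closed continuous = record
  { isKleeneAlgebra = isKleeneAlgebra S sub star-closed closed continuous
  ; star-sup        = λ x Sx a → refl
  ; left-cont       = λ x y Sx Sy a → refl
  ; right-cont      = λ x y Sx Sy → preserves-star x y (closed x Sx) (finAdd y Sy) (continuous y Sy)
  }
  where
    open Theory L
    open IsSubsemiringFinAdd sub using () renaming (⊆FinAdd to finAdd)
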